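{- Let $\mathbf{A}$ be a finite subdirectly irreducible algebra of finite type which is totally non-projective. Then the variety $\mathrm{V}(\mathbf{A})$ generated by $\mathbf{A}$ is not structurally complete.
   Context: For a class $\mathsf{K}$ of algebras and $\mathbf{A}\in\mathsf{K}$, $\mathbf{A}$ is weakly projective in $\mathsf{K}$ if for every $\mathbf{B}\in\mathsf{K}$, whenever $\mathbf{A}$ is a homomorphic image of $\mathbf{B}$, $\mathbf{A}$ is isomorphic to a subalgebra of $\mathbf{B}$. $\mathbf{A}$ is totally non-projective if it is not weakly projective in the variety $\mathrm{V}(\mathbf{A})$ it generates. A variety $\mathsf{V}$ is structurally complete if for any quasivarieties $\mathsf{Q}_1,\mathsf{Q}_2$ whose generated varieties both equal $\mathsf{V}$, one has $\mathsf{Q}_1=\mathsf{Q}_2$. -}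

module Defs where

open import Level using (Level; _⊔_) renaming (suc to lsuc; zero to lzero)
open import Data.Nat using (ℕ)
open import Data.Fin using (Fin)
open import Data.Product using (Σ; ∃; _×_; _,_)
open import Data.List using (List)
open import Data.List.Relation.Unary.All using (All)
open import Relation.Binary.Core using (Rel)
open import Relation.Binary.Structures using (IsEquivalence)
open import Relation.Binary.PropositionalEquality using (_≡_)
open import Relation.Nullary using (¬_)

record Signature : Set where
  field
    nOps  : ℕ
    arity : Fin nOps → ℕ
open Signature public

module _ (S : Signature) where

  -- Algebras over a setoid carrier (no quotient types in Agda).
  record Algebra : Set₁ where
    field
      Carrier : Set
      _≈_     : Rel Carrier lzero
      isEquivalence : IsEquivalence _≈_
      op      : (f : Fin (nOps S)) → (Fin (arity S f) → Carrier) → Carrier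
      op-cong : ∀ f {xs ys : Fin (arity S f) → Carrier} →
                (∀ i → xs i ≈ ys i) → op f xs ≈ op f ys
  open Algebra public

  record Hom (A B : Algebra) : Set where
    field
      fun  : Carrier A → Carrier B
      cong : ∀ {x y} → _≈_ A x y → _≈_ B (fun x) (fun y)
      hom  : ∀ f (xs : Fin (arity S f) → Carrier A) →
             _≈_ B (fun (op A f xs)) (op B f (λ i → fun (xs i)))
  open Hom public

  HomImage : Algebra → Algebra → Set
  HomImage A B = Σ (Hom B A) λ h → ∀ a → ∃ λ b → _≈_ A (fun h b) a

  EmbedsInto : Algebra → Algebra → Set
  EmbedsInto A B = Σ (Hom A B) λ h → ∀ x y → _≈_ B (fun h x) (fun h y) → _≈_ A x y

  Finite : Algebra → Set
  Finite A = ∃ λ n → Σ (Fin n → Carrier A) λ e →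
               (∀ a → ∃ λ i → _≈_ A (e i) a) × (∀ i j → _≈_ A (e i) (e j) → i ≡ j)

  record IsCongruence (A : Algebra) (θ : Rel (Carrier A) lzero) : Set where
    field
      equiv   : IsEquivalence θ
      ⊇≈      : ∀ {x y} → _≈_ A x y → θ x y
      compat  : ∀ f {xs ys : Fin (arity S f) → Carrier A} →
                (∀ i → θ (xs i) (ys i)) → θ (op A f xs) (op A f ys)

  NonTrivialCong : (A : Algebra) → Rel (Carrier A) lzero → Set
  NonTrivialCong A θ = IsCongruence A θ × (∃ λ x → ∃ λ y → θ x y × ¬ (_≈_ A x y))

  SubdirectlyIrreducible : Algebra → Set₁
  SubdirectlyIrreducible A =
    Σ (Rel (Carrier A) lzero) λ μ → NonTrivialCong A μ ×
      (∀ (ψ : Rel (Carrier A) lzero) → NonTrivialCong A ψ → ∀ x y → μ x y → ψ x y)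

  data Term : Set where
    var : ℕ → Term
    app : (f : Fin (nOps S)) → (Fin (arity S f) → Term) → Term

  eval : (A : Algebra) → (ℕ → Carrier A) → Term → Carrier A
  eval A ρ (var n)    = ρ n
  eval A ρ (app f ts) = op A f (λ i → eval A ρ (ts i))

  Eqn : Set
  Eqn = Term × Term

  _⊨ₑ_ : Algebra → Eqn → Set
  A ⊨ₑ (s , t) = ∀ (ρ : ℕ → Carrier A) → _≈_ A (eval A ρ s) (eval A ρ t)

  QuasiIdentity : Set
  QuasiIdentity = List Eqn × Eqn

  _⊨q_ : Algebra → QuasiIdentity → Set
  A ⊨q (ps , (s , t)) = ∀ (ρ : ℕ → Carrier A) →
    All (λ { (u , v) → _≈_ A (eval A ρ u) (eval A ρ v) }) ps →
    _≈_ A (eval A ρ s) (eval A ρ t)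

  Class : (ℓ : Level) → Set (lsuc lzero ⊔ lsuc ℓ)
  Class ℓ = Algebra → Set ℓ

  _≐_ : ∀ {ℓ₁ ℓ₂} → Class ℓ₁ → Class ℓ₂ → Set (lsuc lzero ⊔ ℓ₁ ⊔ ℓ₂)
  K ≐ L = ∀ B → (K B → L B) × (L B → K B)

  ModQ : (QuasiIdentity → Set) → Class lzero
  ModQ Σq B = ∀ q → Σq q → B ⊨q q

  IsQuasivariety : Class lzero → Set₁
  IsQuasivariety Q = Σ (QuasiIdentity → Set) λ Σq → Q ≐ ModQ Σq

  -- Variety generated by a class K (= Mod Id(K), by Birkhoff's HSP theorem).
  VarOf : ∀ {ℓ} → Class ℓ → Class (lsuc lzero ⊔ ℓ)
  VarOf K B = ∀ (e : Eqn) → (∀ C → K C → C ⊨ₑ e) → B ⊨ₑ e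

  V : Algebra → Class (lsuc lzero)
  V A = VarOf (λ C → C ≡ A)

  WeaklyProjectiveIn : ∀ {ℓ} → Algebra → Class ℓ → Set (lsuc lzero ⊔ ℓ)
  WeaklyProjectiveIn A K = ∀ B → K B → HomImage A B → EmbedsInto A B

  TotallyNonProjective : Algebra → Set₁
  TotallyNonProjective A = ¬ WeaklyProjectiveIn A (V A)

  StructurallyComplete : ∀ {ℓ} → Class ℓ → Set (lsuc lzero ⊔ ℓ)
  StructurallyComplete 𝕍 = ∀ (Q₁ Q₂ : Class lzero) →
    IsQuasivariety Q₁ → IsQuasivariety Q₂ →
    VarOf Q₁ ≐ 𝕍 → VarOf Q₂ ≐ 𝕍 → Q₁ ≐ Q₂

{-# OPTIONS --safe #-}
module Submission where

-- If V(A) were structurally complete, A and the free algebra F of V(A) over ω, which satisfy the same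
-- identities and hence generate the same variety, would satisfy the same quasi-identities. The
-- quasi-identity "diagram of A ⇒ x_a = x_b", for a monolith pair a ≠ b, fails in A. It holds in F: a
-- solution of the diagram in F is a homomorphism t : A → F, and composing with any evaluation
-- F → A gives an endomorphism of A which either identifies a and b or, being then injective by
-- subdirect irreducibility, makes A weakly projective in V(A) (lift the valuation along a surjection
-- B ↠ A). Total non-projectivity excludes the second case.

open import Defs
open import Level using () renaming (zero to lzero)
open import Data.Nat using (ℕ; _<?_; _^_)
open import Data.Fin using (Fin; toℕ; fromℕ<; _≟_; finToFun; funToFin)
open import Data.Fin.Properties using (toℕ<n; fromℕ<-toℕ; finToFun-funToFin)
open import Data.Product using (_×_; _,_; proj₁; proj₂)
open import Data.List using (List; []; concat; tabulate)
open import Data.List.Relation.Unary.All using (All; [])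
import Data.List.Relation.Unary.All.Properties as All
open import Function using (_∘_; id)
open import Relation.Binary.Core using (Rel)
open import Relation.Binary.Definitions using (Decidable)
open import Relation.Binary.Structures using (IsEquivalence)
open import Relation.Binary.PropositionalEquality as ≡ using (_≡_; refl)
open import Relation.Nullary using (¬_; yes; no; contradiction)
open import Relation.Nullary.Decidable using (map′)

module Universal (S : Signature) where

  private
    variable
      A B C D : Algebra S

  module ≈ (A : Algebra S) = IsEquivalence (isEquivalence A)

  _⊨_ : Algebra S → Eqn S → Set
  _⊨_ = _⊨ₑ_ S

  idʰ : Hom S A A
  idʰ {A} = record { fun = id ; cong = id ; hom = λ f xs → ≈.refl A }

  _∘ʰ_ : Hom S B C → Hom S A B → Hom S A C
  _∘ʰ_ {C = C} g h = record
    { fun  = fun g ∘ fun h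
    ; cong = cong g ∘ cong h
    ; hom  = λ f xs → ≈.trans C (cong g (hom h f xs)) (hom g f (fun h ∘ xs))
    }

  Injective : Hom S A B → Set
  Injective {A} {B} h = ∀ x y → _≈_ B (fun h x) (fun h y) → _≈_ A x y

  kernel : Hom S A B → Rel (Carrier A) lzero
  kernel {B = B} h x y = _≈_ B (fun h x) (fun h y)

  kernel-isCongruence : (h : Hom S A B) → IsCongruence S A (kernel h)
  kernel-isCongruence {A} {B} h = record
    { equiv  = record { refl = ≈.refl B ; sym = ≈.sym B ; trans = ≈.trans B }
    ; ⊇≈     = cong h
    ; compat = λ f {xs} {ys} hxs≈hys →
        ≈.trans B (hom h f xs) (≈.trans B (op-cong B f hxs≈hys) (≈.sym B (hom h f ys)))
    }

  separating⇒injective : Decidable (_≈_ A) → ∀ {a b} → (∀ ψ → NonTrivialCong S A ψ → ψ a b) →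
    (h : Hom S A B) → ¬ kernel h a b → Injective h
  separating⇒injective _≟ᴬ_ below h h-separates x y hx≈hy with x ≟ᴬ y
  ... | yes x≈y = x≈y
  ... | no x≉y  = contradiction (below (kernel h) (kernel-isCongruence h , x , y , hx≈hy , x≉y)) h-separates

  eval-cong : (C : Algebra S) {ρ σ : ℕ → Carrier C} → (∀ k → _≈_ C (ρ k) (σ k)) →
    ∀ s → _≈_ C (eval S C ρ s) (eval S C σ s)
  eval-cong C ρ≈σ (var k)    = ρ≈σ k
  eval-cong C ρ≈σ (app f ts) = op-cong C f (λ i → eval-cong C ρ≈σ (ts i))

  eval-hom : (h : Hom S B C) (ρ : ℕ → Carrier B) →
    ∀ s → _≈_ C (fun h (eval S B ρ s)) (eval S C (fun h ∘ ρ) s)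
  eval-hom {C = C} h ρ (var k)    = ≈.refl C
  eval-hom {C = C} h ρ (app f ts) =
    ≈.trans C (hom h f _) (op-cong C f (λ i → eval-hom h ρ (ts i)))

  V-⊨ : (D B : Algebra S) → V S D B → ∀ e → D ⊨ e → B ⊨ e
  V-⊨ D B B∈V e D⊨e = B∈V e (λ { _ refl → D⊨e })

  V-refl : (D : Algebra S) → V S D D
  V-refl D e holds = holds D refl

  FreeAlgebra : Algebra S → Algebra S
  FreeAlgebra D = record
    { Carrier       = Term S
    ; _≈_           = λ s t → D ⊨ (s , t)
    ; isEquivalence = record
        { refl  = λ ρ → ≈.refl D
        ; sym   = λ s≈t ρ → ≈.sym D (s≈t ρ)
        ; trans = λ s≈t t≈u ρ → ≈.trans D (s≈t ρ) (t≈u ρ)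
        }
    ; op            = app
    ; op-cong       = λ f ss≈ts ρ → op-cong D f (λ i → ss≈ts i ρ)
    }

  eval-subst : (C D : Algebra S) (ρ : ℕ → Carrier C) (σ : ℕ → Term S) →
    ∀ s → _≈_ C (eval S C ρ (eval S (FreeAlgebra D) σ s)) (eval S C (eval S C ρ ∘ σ) s)
  eval-subst C D ρ σ (var k)    = ≈.refl C
  eval-subst C D ρ σ (app f ts) = op-cong C f (λ i → eval-subst C D ρ σ (ts i))

  EquationallyEquivalent : Algebra S → Algebra S → Set
  EquationallyEquivalent A D = ∀ e → (A ⊨ e → D ⊨ e) × (D ⊨ e → A ⊨ e)

  FreeAlgebra-equivalent : (D : Algebra S) → EquationallyEquivalent D (FreeAlgebra D)
  FreeAlgebra-equivalent D (s , t) = to , from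
    where
    to : D ⊨ (s , t) → FreeAlgebra D ⊨ (s , t)
    to D⊨s≈t σ ρ = ≈.trans D (eval-subst D D ρ σ s)
                     (≈.trans D (D⊨s≈t _) (≈.sym D (eval-subst D D ρ σ t)))
    from : FreeAlgebra D ⊨ (s , t) → D ⊨ (s , t)
    from F⊨s≈t ρ = ≈.trans D (≈.sym D (eval-subst D D ρ var s))
                     (≈.trans D (F⊨s≈t var ρ) (eval-subst D D ρ var t))

  liftʰ : (D B : Algebra S) → V S D B → (ℕ → Carrier B) → Hom S (FreeAlgebra D) B
  liftʰ D B B∈V ρ = record
    { fun  = eval S B ρ
    ; cong = λ {s} {t} D⊨s≈t → V-⊨ D B B∈V (s , t) D⊨s≈t ρ
    ; hom  = λ f ts → ≈.refl B
    }

  weaklyProjective-via-free : (t : Hom S A (FreeAlgebra A)) (ρ : ℕ → Carrier A) →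
    Injective (liftʰ A A (V-refl A) ρ ∘ʰ t) → WeaklyProjectiveIn S A (V S A)
  weaklyProjective-via-free {A} t ρ injective B B∈V (h , h-onto) =
    liftʰ A B B∈V ρ′ ∘ʰ t , λ x y tx≈ty → injective x y (via-h (fun t x) (fun t y) (cong h tx≈ty))
    where
    ρ′ : ℕ → Carrier B
    ρ′ k = proj₁ (h-onto (ρ k))

    h∘eval : ∀ s → _≈_ A (fun h (eval S B ρ′ s)) (eval S A ρ s)
    h∘eval s = ≈.trans A (eval-hom h ρ′ s) (eval-cong A (λ k → proj₂ (h-onto (ρ k))) s)

    via-h : ∀ s u → _≈_ A (fun h (eval S B ρ′ s)) (fun h (eval S B ρ′ u)) →
      _≈_ A (eval S A ρ s) (eval S A ρ u)
    via-h s u hs≈hu = ≈.trans A (≈.sym A (h∘eval s)) (≈.trans A hs≈hu (h∘eval u))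

  QuasivarietyOf : Algebra S → Class S lzero
  QuasivarietyOf D = ModQ S (_⊨q_ S D)

  QuasivarietyOf-isQuasivariety : (D : Algebra S) → IsQuasivariety S (QuasivarietyOf D)
  QuasivarietyOf-isQuasivariety D = _⊨q_ S D , λ B → id , id

  QuasivarietyOf-⊨ : (D C : Algebra S) → QuasivarietyOf D C → ∀ e → D ⊨ e → C ⊨ e
  QuasivarietyOf-⊨ D C C∈Q e D⊨e ρ = C∈Q ([] , e) (λ ρ′ _ → D⊨e ρ′) ρ []

  VarOf-QuasivarietyOf : EquationallyEquivalent A D → _≐_ S (VarOf S (QuasivarietyOf D)) (V S A)
  VarOf-QuasivarietyOf {A} {D} A≃D B =
      (λ B∈VQ e A⊨e → B∈VQ e (λ C C∈Q → QuasivarietyOf-⊨ D C C∈Q e (proj₁ (A≃D e) (A⊨e A refl))))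
    , (λ B∈V e Q⊨e → V-⊨ A B B∈V e (proj₂ (A≃D e) (Q⊨e D (λ q D⊨q → D⊨q))))

  structurallyComplete⇒⊨q : StructurallyComplete S (V S A) → EquationallyEquivalent A D →
    ∀ q → _⊨q_ S D q → _⊨q_ S A q
  structurallyComplete⇒⊨q {A} {D} complete A≃D = proj₁ (Q[A]≐Q[D] A) (λ q A⊨q → A⊨q)
    where
    Q[A]≐Q[D] : _≐_ S (QuasivarietyOf A) (QuasivarietyOf D)
    Q[A]≐Q[D] = complete (QuasivarietyOf A) (QuasivarietyOf D)
      (QuasivarietyOf-isQuasivariety A) (QuasivarietyOf-isQuasivariety D)
      (VarOf-QuasivarietyOf {A} {A} (λ e → id , id)) (VarOf-QuasivarietyOf {A} {D} A≃D)

  Holds : (C : Algebra S) → (ℕ → Carrier C) → Eqn S → Set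
  Holds C ρ (s , t) = _≈_ C (eval S C ρ s) (eval S C ρ t)

  module Diagram (A : Algebra S) (fin : Finite S A) where

    private
      n : ℕ
      n = proj₁ fin

      enum : Fin n → Carrier A
      enum = proj₁ (proj₂ fin)

      index : Carrier A → Fin n
      index a = proj₁ (proj₁ (proj₂ (proj₂ fin)) a)

      enum-index : ∀ a → _≈_ A (enum (index a)) a
      enum-index a = proj₂ (proj₁ (proj₂ (proj₂ fin)) a)

      enum-injective : ∀ i j → _≈_ A (enum i) (enum j) → i ≡ j
      enum-injective = proj₂ (proj₂ (proj₂ fin))

      index-cong : ∀ {a b} → _≈_ A a b → index a ≡ index b
      index-cong {a} {b} a≈b = enum-injective _ _
        (≈.trans A (enum-index a) (≈.trans A a≈b (≈.sym A (enum-index b))))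

      index-injective : ∀ {a b} → index a ≡ index b → _≈_ A a b
      index-injective {a} {b} eq =
        ≈.trans A (≈.sym A (enum-index a)) (≈.trans A (≈.reflexive A (≡.cong enum eq)) (enum-index b))

    _≟ᴬ_ : Decidable (_≈_ A)
    a ≟ᴬ b = map′ index-injective index-cong (index a ≟ index b)

    -- The variable x_a of the diagram of A is var (code a).
    code : Carrier A → ℕ
    code a = toℕ (index a)

    code-cong : ∀ {a b} → _≈_ A a b → code a ≡ code b
    code-cong = ≡.cong toℕ ∘ index-cong

    decode : Carrier A → ℕ → Carrier A
    decode default k with k <? n
    ... | yes k<n = enum (fromℕ< k<n)
    ... | no _    = default

    decode-code : ∀ default a → _≈_ A (decode default (code a)) a
    decode-code default a with code a <? n
    ... | yes a<n = ≈.trans A (≈.reflexive A (≡.cong enum (fromℕ<-toℕ (index a) a<n))) (enum-index a)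
    ... | no a≮n  = contradiction (toℕ<n (index a)) a≮n

    tuple : ∀ {k} → Fin (n ^ k) → Fin k → Carrier A
    tuple j = enum ∘ finToFun j

    tuple-funToFin : ∀ {k} (xs : Fin k → Carrier A) → ∀ i → _≈_ A (tuple (funToFin (index ∘ xs)) i) (xs i)
    tuple-funToFin xs i =
      ≈.trans A (≈.reflexive A (≡.cong enum (finToFun-funToFin (index ∘ xs) i))) (enum-index (xs i))

    diagramEqn : (f : Fin (nOps S)) → (Fin (arity S f) → Carrier A) → Eqn S
    diagramEqn f xs = app f (λ i → var (code (xs i))) , var (code (op A f xs))

    diagramEqn-resp : ∀ {C ρ f} {xs ys : Fin (arity S f) → Carrier A} → (∀ i → _≈_ A (xs i) (ys i)) →
      Holds C ρ (diagramEqn f xs) → Holds C ρ (diagramEqn f ys)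
    diagramEqn-resp {C} {ρ} {f} xs≈ys holds =
      ≈.trans C (op-cong C f (λ i → ≈.reflexive C (≡.cong ρ (code-cong (≈.sym A (xs≈ys i))))))
        (≈.trans C holds (≈.reflexive C (≡.cong ρ (code-cong (op-cong A f xs≈ys)))))

    -- One premise per operation symbol and tuple of elements; Fin (n ^ k) enumerates the k-tuples.
    diagramPremises : List (Eqn S)
    diagramPremises = concat (tabulate λ f → tabulate λ j → diagramEqn f (tuple j))

    diagram : Carrier A → Carrier A → QuasiIdentity S
    diagram a b = diagramPremises , (var (code a) , var (code b))

    diagram-hom : (C : Algebra S) (ρ : ℕ → Carrier C) → All (Holds C ρ) diagramPremises → Hom S A C
    diagram-hom C ρ holds = record
      { fun  = ρ ∘ code
      ; cong = ≈.reflexive C ∘ ≡.cong ρ ∘ code-cong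
      ; hom  = λ f xs → ≈.sym C (holds-everywhere f xs)
      }
      where
      holds-everywhere : ∀ f xs → Holds C ρ (diagramEqn f xs)
      holds-everywhere f xs = diagramEqn-resp {C} {ρ} (tuple-funToFin xs)
        (All.tabulate⁻ (All.tabulate⁻ (All.concat⁻ holds) f) (funToFin (index ∘ xs)))

    hom⇒diagramPremises : (h : Hom S A C) (ρ : ℕ → Carrier C) → (∀ a → _≈_ C (ρ (code a)) (fun h a)) →
      All (Holds C ρ) diagramPremises
    hom⇒diagramPremises {C} h ρ ρ≈h =
      All.concat⁺ (All.tabulate⁺ λ f → All.tabulate⁺ λ j → holds f (tuple j))
      where
      holds : ∀ f xs → Holds C ρ (diagramEqn f xs)
      holds f xs = ≈.trans C (op-cong C f (λ i → ρ≈h (xs i)))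
        (≈.trans C (≈.sym C (hom h f xs)) (≈.sym C (ρ≈h (op A f xs))))

    A⊭diagram : ∀ {a b} → ¬ _≈_ A a b → ¬ _⊨q_ S A (diagram a b)
    A⊭diagram {a} {b} a≉b A⊨diagram = a≉b
      (≈.trans A (≈.sym A (decode-code a a))
        (≈.trans A (A⊨diagram (decode a) (hom⇒diagramPremises idʰ (decode a) (decode-code a)))
          (decode-code a b)))

    FreeAlgebra⊨diagram : TotallyNonProjective S A → ∀ {a b} → (∀ ψ → NonTrivialCong S A ψ → ψ a b) →
      _⊨q_ S (FreeAlgebra A) (diagram a b)
    FreeAlgebra⊨diagram non-projective {a} {b} below σ holds ρ
      with eval S A ρ (σ (code a)) ≟ᴬ eval S A ρ (σ (code b))
    ... | yes ta≈tb = ta≈tb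
    ... | no ta≉tb  = contradiction
      (weaklyProjective-via-free t ρ (separating⇒injective _≟ᴬ_ below (liftʰ A A (V-refl A) ρ ∘ʰ t) ta≉tb))
      non-projective
      where
      t : Hom S A (FreeAlgebra A)
      t = diagram-hom (FreeAlgebra A) σ holds

proposition20 : (S : Signature) (A : Algebra S) →
    Finite S A → SubdirectlyIrreducible S A → TotallyNonProjective S A →
    ¬ StructurallyComplete S (V S A)
proposition20 S A fin (μ , (_ , a , b , μab , a≉b) , μ-least) non-projective complete =
  A⊭diagram a≉b
    (structurallyComplete⇒⊨q {A} {FreeAlgebra A} complete (FreeAlgebra-equivalent A) (diagram a b)
      (FreeAlgebra⊨diagram non-projective (λ ψ ψ-nontrivial → μ-least ψ ψ-nontrivial a b μab)))
  where
  open Universal S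
  open Diagram A fin
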